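{- Let $r\ge 1$ be an integer and let $G$ be a $(4,r)$-graph. Then $G$ has edge-connectivity (and hence minimum degree) at least $3r+3$, and $G$ has maximum degree at most $|V(G)|-(2r+3)$. In particular, $G$ has at least $5r+6$ vertices.
   Context: All graphs are finite and simple. A vertex, edge, or set of edges of a graph $G$ is critical if removing it produces a graph with smaller chromatic number than $G$. A graph $G$ with $\chi(G)=k$ is $k$-vertex-critical if every vertex is critical. For $k\ge 4$, $r\ge 1$, a $(k,r)$-graph is a $k$-vertex-critical graph in which no set of at most $r$ edges is critical. -}

module Defs where

open import Data.Nat using (ℕ; zero; suc; _+_; _≤_; _<_)
open import Data.Bool using (Bool; true; false; not; _∧_; _∨_; if_then_else_)
open import Data.Fin using (Fin; punchIn; _≟_)
open import Data.List using (List; []; _∷_; length; map)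
open import Data.Bool.ListAction using (any)
open import Data.Nat.ListAction using (sum)
open import Data.List.Relation.Unary.All using (All)
open import Data.List using (allFin)
open import Data.Product using (Σ; _×_; _,_; proj₁; proj₂)
open import Relation.Nullary using (¬_)
open import Relation.Nullary.Decidable using (isYes)
open import Relation.Binary.PropositionalEquality using (_≡_; _≢_)

record Graph (n : ℕ) : Set where
  field
    adj   : Fin n → Fin n → Bool
    sym   : ∀ u v → adj u v ≡ adj v u
    irrefl : ∀ u → adj u u ≡ false
open Graph public

Colorable : ∀ {n} → Graph n → ℕ → Set
Colorable {n} G k =
  Σ (Fin n → Fin k) λ c → ∀ u v → adj G u v ≡ true → c u ≢ c v

ChromaticNumber : ∀ {n} → Graph n → ℕ → Set
ChromaticNumber G k = Colorable G k × (∀ j → Colorable G j → k ≤ j)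

deleteVertex : ∀ {n} → Graph (suc n) → Fin (suc n) → Graph n
deleteVertex G v = record
  { adj = λ a b → adj G (punchIn v a) (punchIn v b)
  ; sym = λ a b → sym G (punchIn v a) (punchIn v b)
  ; irrefl = λ a → irrefl G (punchIn v a) }

Edge : ℕ → Set
Edge n = Fin n × Fin n

IsEdge : ∀ {n} → Graph n → Edge n → Set
IsEdge G (u , v) = adj G u v ≡ true

inEdges : ∀ {n} → List (Edge n) → Fin n → Fin n → Bool
inEdges F u v = any (λ e → matches e u v ∨ matches e v u) F
  where
  matches : ∀ {n} → Edge n → Fin n → Fin n → Bool
  matches (a , b) x y = isYes (a ≟ x) ∧ isYes (b ≟ y)

deleteEdges : ∀ {n} → Graph n → List (Edge n) → Graph n
deleteEdges {n} G F = record
  { adj = λ u v → adj G u v ∧ not (inEdges F u v)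
  ; sym = symm
  ; irrefl = irr }
  where
  open import Data.Bool.Properties using (∨-comm)
  open import Relation.Binary.PropositionalEquality using (cong₂; cong)
  open import Data.List.Properties using ()
  lemF : ∀ (F : List (Edge n)) u v → inEdges F u v ≡ inEdges F v u
  lemF [] u v = Relation.Binary.PropositionalEquality.refl
  lemF ((a , b) ∷ F) u v = cong₂ _∨_ (∨-comm (isYes (a ≟ u) ∧ isYes (b ≟ v)) (isYes (a ≟ v) ∧ isYes (b ≟ u))) (lemF F u v)
  symm : ∀ u v → (adj G u v ∧ not (inEdges F u v)) ≡ (adj G v u ∧ not (inEdges F v u))
  symm u v = cong₂ _∧_ (sym G u v) (cong not (lemF F u v))
  irr : ∀ u → (adj G u u ∧ not (inEdges F u u)) ≡ false
  irr u rewrite irrefl G u = Relation.Binary.PropositionalEquality.refl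

VertexCritical : ∀ {n} → ℕ → Graph n → Set
VertexCritical {zero} k G = ChromaticNumber G k
VertexCritical {suc n} k G =
  ChromaticNumber G k ×
  (∀ v → Σ ℕ λ j → ChromaticNumber (deleteVertex G v) j × j < k)

CriticalEdgeSet : ∀ {n} → Graph n → ℕ → List (Edge n) → Set
CriticalEdgeSet G k F = Σ ℕ λ j → ChromaticNumber (deleteEdges G F) j × j < k

KRGraph : ∀ {n} → ℕ → ℕ → Graph n → Set
KRGraph k r G =
  VertexCritical k G ×
  (∀ (F : List (Edge _)) → All (IsEdge G) F → length F ≤ r → ¬ CriticalEdgeSet G k F)

data Reach {n} (G : Graph n) : Fin n → Fin n → Set where
  here : ∀ {u} → Reach G u u
  step : ∀ {u w v} → adj G u w ≡ true → Reach G w v → Reach G u v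

Connected : ∀ {n} → Graph n → Set
Connected {n} G = ∀ (u v : Fin n) → Reach G u v

EdgeConnectivityAtLeast : ∀ {n} → Graph n → ℕ → Set
EdgeConnectivityAtLeast G m =
  ∀ (F : List (Edge _)) → All (IsEdge G) F → length F < m → Connected (deleteEdges G F)

degree : ∀ {n} → Graph n → Fin n → ℕ
degree {n} G u = sum (map (λ v → if adj G u v then 1 else 0) (allFin n))

{-# OPTIONS --safe #-}
module Submission where

-- Everything rests on one observation: in a (k,r)-graph G no (k-1)-colouring has all its
-- monochromatic edges inside a set of at most r edges of G, for deleting that set would lower χ.
-- Take a (k-1)-colouring c of G - z and recolour z with a colour a: the monochromatic edges are the
-- edges from z to N(z) ∩ c⁻¹(a), so every colour class meets N(z) in more than r vertices, and
-- summing over the k-1 classes bounds the degree from below. If x ∉ N[v] and c colours G - x, the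
-- class of c(v) in N(x) avoids N[v]; for y in it and c' colouring G - y, the class of c'(v) in N(y)
-- avoids N[v] and the first class, so n ≥ deg v + 1 + 2(r+1). Finally, for an edge cut between
-- S ∋ u and its complement ∋ w, colour S by a 3-colouring of G - w and the complement by the three
-- cyclic shifts of a 3-colouring of G - u: a cut edge is monochromatic for at most one shift and
-- no other edge for any, so the cut has at least 3(r+1) edges.

open import Defs hiding (sym)
open import Data.Bool using (true; false; _∧_; _∨_; if_then_else_; T)
import Data.Bool as Bool
open import Data.Bool.Properties using (T-≡; T-∧; T-∨; ¬-not)
open import Data.Empty using (⊥; ⊥-elim)
open import Data.Fin using (Fin; zero; suc; toℕ; punchIn; punchOut; inject≤; _≟_)
open import Data.Fin.Properties using (suc-injective; 0≢1+n; any?; all?; punchIn-punchOut; inject≤-injective)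
open import Data.Fin.Subset using (Subset; ⁅_⁆; ∣_∣; _∪_) renaming (_∈_ to _∈ₛ_; _∉_ to _∉ₛ_)
open import Data.Fin.Subset.Properties
  using (x∈⁅x⁆; x∈⁅y⁆⇒x≡y; p⊆p∪q; x∈p∪q⁺; x∈p∪q⁻; p⊂q⇒∣p∣<∣q∣; ∣p∣≤n)
  renaming (_∈?_ to _∈ₛ?_)
open import Data.List using (List; []; _∷_; length; map; allFin; tabulate; filter)
open import Data.List.Properties using (map-tabulate; length-map)
open import Data.List.Membership.Propositional using (_∈_)
open import Data.List.Membership.Propositional.Properties using (∈-map⁺; ∈-filter⁺; ∈-allFin)
open import Data.List.Relation.Unary.All as All using (All; []; _∷_)
open import Data.List.Relation.Unary.All.Properties as All using (all-filter)
import Data.List.Relation.Unary.Any as Any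
open import Data.List.Relation.Unary.Any.Properties using (any⁺; any⁻; Any-⊎⁺; Any-⊎⁻)
open import Data.Nat using (ℕ; zero; suc; _+_; _*_; _≤_; _<_; z≤n; s≤s)
open import Data.Nat.DivMod using (_mod_)
open import Data.Nat.ListAction using (sum)
open import Data.Nat.Properties
  using ( +-0-commutativeMonoid; ≤-refl; ≤-reflexive; ≤-trans; <-≤-trans; ≤-pred; m≤n⇒m≤1+n; ≰⇒>; <⇒≱
        ; +-mono-≤; +-monoˡ-≤; +-monoʳ-≤; m≤m+n; m≤n+m; m<m+n; +-suc; *-identityʳ; module ≤-Reasoning)
open import Data.Nat.Tactic.RingSolver using (solve-∀)
open import Algebra.Properties.CommutativeMonoid.Sum +-0-commutativeMonoid
  using (sum-syntax; sum-cong-≗; ∑-distrib-+; ∑-comm; sum-replicate-zero)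
open import Data.Product using (Σ; ∃; ∃₂; _×_; _,_; proj₁; proj₂)
open import Data.Sum as Sum using (_⊎_; inj₁; inj₂)
open import Function using (_∘_; const; _⇔_; Equivalence; mk⇔)
open import Level using (Level)
open import Relation.Binary.PropositionalEquality using (_≡_; _≢_; refl; sym; trans; cong; cong₂; subst)
open import Relation.Nullary using (¬_; Dec; yes; no; does; contradiction)
open import Relation.Nullary.Decidable using (isYes; fromWitness; toWitness; decidable-stable)
open import Relation.Nullary.Decidable.Core using (¬¬-excluded-middle; _×-dec_; _→-dec_; ¬?; from-yes)
open import Relation.Unary using (Pred; Decidable; _⊆_)
open import Relation.Unary.Properties using (_∪?_; _∩?_)

∑-mono-≤ : ∀ {n} {f g : Fin n → ℕ} → (∀ i → f i ≤ g i) → ∑[ i < n ] f i ≤ ∑[ i < n ] g i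
∑-mono-≤ {zero}  f≤g = z≤n
∑-mono-≤ {suc n} f≤g = +-mono-≤ (f≤g zero) (∑-mono-≤ (f≤g ∘ suc))

∑-const : ∀ n c → ∑[ i < n ] c ≡ n * c
∑-const zero    c = refl
∑-const (suc n) c = cong (c +_) (∑-const n c)

sum-tabulate : ∀ {n} (f : Fin n → ℕ) → sum (tabulate f) ≡ ∑[ i < n ] f i
sum-tabulate {zero}  f = refl
sum-tabulate {suc n} f = cong (f zero +_) (sum-tabulate (f ∘ suc))

sum-allFin : ∀ n (f : Fin n → ℕ) → sum (map f (allFin n)) ≡ ∑[ i < n ] f i
sum-allFin n f = trans (cong sum (map-tabulate (λ i → i) f)) (sum-tabulate f)

𝟙 : ∀ {p} {P : Set p} → Dec P → ℕ
𝟙 P? = if does P? then 1 else 0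

count : ∀ {n p} {P : Pred (Fin n) p} → Decidable P → ℕ
count {n} P? = ∑[ i < n ] 𝟙 (P? i)

module _ {n p q} {P : Pred (Fin n) p} {Q : Pred (Fin n) q} (P? : Decidable P) (Q? : Decidable Q) where

  count-mono : P ⊆ Q → count P? ≤ count Q?
  count-mono P⊆Q = ∑-mono-≤ pointwise
    where
    pointwise : ∀ i → 𝟙 (P? i) ≤ 𝟙 (Q? i)
    pointwise i with P? i | Q? i
    ... | yes Pi | no ¬Qi = contradiction (P⊆Q Pi) ¬Qi
    ... | yes _  | yes _  = ≤-refl
    ... | no _   | _      = z≤n

  count-∪ : (∀ {i} → P i → Q i → ⊥) → count (P? ∪? Q?) ≡ count P? + count Q?
  count-∪ disjoint = trans (sum-cong-≗ pointwise) (∑-distrib-+ (𝟙 ∘ P?) (𝟙 ∘ Q?))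
    where
    pointwise : ∀ i → 𝟙 ((P? ∪? Q?) i) ≡ 𝟙 (P? i) + 𝟙 (Q? i)
    pointwise i with P? i | Q? i
    ... | yes Pi | yes Qi = ⊥-elim (disjoint Pi Qi)
    ... | yes _  | no _   = refl
    ... | no _   | yes _  = refl
    ... | no _   | no _   = refl

module _ {p : Level} where

  count≤n : ∀ {n} {P : Pred (Fin n) p} (P? : Decidable P) → count P? ≤ n
  count≤n {n} P? = begin
    count P?        ≤⟨ ∑-mono-≤ 𝟙≤1 ⟩
    ∑[ i < n ] 1    ≡⟨ ∑-const n 1 ⟩
    n * 1           ≡⟨ *-identityʳ n ⟩
    n               ∎
    where
    open ≤-Reasoning
    𝟙≤1 : ∀ i → 𝟙 (P? i) ≤ 1
    𝟙≤1 i with does (P? i)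
    ... | true  = ≤-refl
    ... | false = z≤n

  count-none : ∀ {n} {P : Pred (Fin n) p} (P? : Decidable P) → (∀ i → ¬ P i) → count P? ≡ 0
  count-none {n} P? none = trans (sum-cong-≗ 𝟙≡0) (sum-replicate-zero n)
    where
    𝟙≡0 : ∀ i → 𝟙 (P? i) ≡ 0
    𝟙≡0 i with P? i
    ... | yes Pi = contradiction Pi (none i)
    ... | no _   = refl

  count≤1 : ∀ {n} {P : Pred (Fin n) p} (P? : Decidable P) → (∀ {i j} → P i → P j → i ≡ j) → count P? ≤ 1
  count≤1 {zero}  P? unique = z≤n
  count≤1 {suc n} P? unique with P? zero
  ... | yes P0 = ≤-reflexive (cong suc (count-none (P? ∘ suc) λ i Pi → 0≢1+n (unique P0 Pi)))
  ... | no _   = count≤1 (P? ∘ suc) λ Pi Pj → suc-injective (unique Pi Pj)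

  0<count⇒∃ : ∀ {n} {P : Pred (Fin n) p} (P? : Decidable P) → 0 < count P? → ∃ P
  0<count⇒∃ {suc n} P? positive with P? zero
  ... | yes P0 = zero , P0
  ... | no _   = let i , Pi = 0<count⇒∃ (P? ∘ suc) positive in suc i , Pi

  P⇒0<count : ∀ {n} {P : Pred (Fin n) p} (P? : Decidable P) {i} → P i → 0 < count P?
  P⇒0<count P? {zero} P0 with P? zero
  ... | yes _   = s≤s z≤n
  ... | no ¬P0  = contradiction P0 ¬P0
  P⇒0<count P? {suc i} Pi = ≤-trans (P⇒0<count (P? ∘ suc) Pi) (m≤n+m _ (𝟙 (P? zero)))

∑-count-classes≤count : ∀ {n k p} {P : Pred (Fin n) p} (P? : Decidable P) (c : Fin n → Fin k) →
  ∑[ a < k ] count (P? ∩? λ w → c w ≟ a) ≤ count P?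
∑-count-classes≤count {n} {k} P? c = begin
  ∑[ a < k ] ∑[ w < n ] 𝟙 (P? w ×-dec (c w ≟ a))  ≡⟨ ∑-comm (λ a w → 𝟙 (P? w ×-dec (c w ≟ a))) ⟩
  ∑[ w < n ] ∑[ a < k ] 𝟙 (P? w ×-dec (c w ≟ a))  ≤⟨ ∑-mono-≤ atMostOneClass ⟩
  count P?                                          ∎
  where
  open ≤-Reasoning
  atMostOneClass : ∀ w → ∑[ a < k ] 𝟙 (P? w ×-dec (c w ≟ a)) ≤ 𝟙 (P? w)
  atMostOneClass w with P? w
  ... | yes _ = count≤1 (λ a → c w ≟ a) λ cw≡a cw≡b → trans (sym cw≡a) cw≡b
  ... | no _  = ≤-reflexive (sum-replicate-zero k)

length-filter : ∀ {a p} {A : Set a} {P : Pred A p} (P? : Decidable P) xs →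
                length (filter P? xs) ≡ sum (map (𝟙 ∘ P?) xs)
length-filter P? []       = refl
length-filter P? (x ∷ xs) with P? x
... | yes _ = cong suc (length-filter P? xs)
... | no _  = length-filter P? xs

length-filter-allFin : ∀ {n p} {P : Pred (Fin n) p} (P? : Decidable P) → length (filter P? (allFin n)) ≡ count P?
length-filter-allFin {n} P? = trans (length-filter P? (allFin n)) (sum-allFin n (𝟙 ∘ P?))

∑-length-filter≤length : ∀ {k a p} {A : Set a} {P : Fin k → Pred A p} (P? : ∀ s → Decidable (P s)) {xs : List A} →
  All (λ x → count (λ s → P? s x) ≤ 1) xs → ∑[ s < k ] length (filter (P? s) xs) ≤ length xs
∑-length-filter≤length {k} P? []                   = ≤-reflexive (sum-replicate-zero k)
∑-length-filter≤length {k} P? {x ∷ xs} (x≤1 ∷ xs≤1) = begin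
  ∑[ s < k ] length (filter (P? s) (x ∷ xs))                   ≡⟨ sum-cong-≗ length-filter-∷ ⟩
  ∑[ s < k ] (𝟙 (P? s x) + length (filter (P? s) xs))          ≡⟨ ∑-distrib-+ (λ s → 𝟙 (P? s x)) _ ⟩
  count (λ s → P? s x) + ∑[ s < k ] length (filter (P? s) xs)  ≤⟨ +-mono-≤ x≤1 (∑-length-filter≤length P? xs≤1) ⟩
  suc (length xs)                                              ∎
  where
  open ≤-Reasoning
  length-filter-∷ : ∀ s → length (filter (P? s) (x ∷ xs)) ≡ 𝟙 (P? s x) + length (filter (P? s) xs)
  length-filter-∷ s = trans (length-filter (P? s) (x ∷ xs)) (cong (𝟙 (P? s x) +_) (sym (length-filter (P? s) xs)))

adj⇒≢ : ∀ {n} (G : Graph n) {u v} → adj G u v ≡ true → u ≢ v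
adj⇒≢ G {u} uv refl with () ← trans (sym uv) (irrefl G u)

degree≡count : ∀ {n} (G : Graph n) v → degree G v ≡ count (λ w → adj G v w Bool.≟ true)
degree≡count {n} G v = trans (sum-allFin n _) (sum-cong-≗ indicator)
  where
  indicator : ∀ w → (if adj G v w then 1 else 0) ≡ 𝟙 (adj G v w Bool.≟ true)
  indicator w with adj G v w
  ... | true  = refl
  ... | false = refl

module _ {n : ℕ} where

  private
    sameEdge : ∀ {a b x y : Fin n} → T (isYes (a ≟ x) ∧ isYes (b ≟ y)) ⇔ (x , y) ≡ (a , b)
    sameEdge {a} {b} {x} {y} = mk⇔
      (λ t → let a≡x , b≡y = Equivalence.to (T-∧ {isYes (a ≟ x)}) t in sym (cong₂ _,_ (toWitness a≡x) (toWitness b≡y)))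
      (λ { refl → Equivalence.from (T-∧ {isYes (a ≟ a)} {isYes (b ≟ b)}) (fromWitness refl , fromWitness refl) })

    edgeMatches : ∀ {a b u v : Fin n} →
      T ((isYes (a ≟ u) ∧ isYes (b ≟ v)) ∨ (isYes (a ≟ v) ∧ isYes (b ≟ u))) ⇔ ((u , v) ≡ (a , b) ⊎ (v , u) ≡ (a , b))
    edgeMatches {a} {b} {u} {v} = mk⇔
      (Sum.map (Equivalence.to sameEdge) (Equivalence.to sameEdge) ∘ Equivalence.to (T-∨ {isYes (a ≟ u) ∧ isYes (b ≟ v)}))
      (Equivalence.from (T-∨ {isYes (a ≟ u) ∧ isYes (b ≟ v)}) ∘ Sum.map (Equivalence.from sameEdge) (Equivalence.from sameEdge))

  inEdges⁺ : ∀ {F : List (Edge n)} {u v} → (u , v) ∈ F ⊎ (v , u) ∈ F → inEdges F u v ≡ true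
  inEdges⁺ uv∈F = Equivalence.to T-≡ (any⁺ _ (Any.map (Equivalence.from edgeMatches) (Any-⊎⁺ uv∈F)))

  inEdges⁻ : ∀ (F : List (Edge n)) u v → inEdges F u v ≡ true → (u , v) ∈ F ⊎ (v , u) ∈ F
  inEdges⁻ F u v uv∈F = Any-⊎⁻ (Any.map (Equivalence.to edgeMatches) (any⁻ _ F (Equivalence.from T-≡ uv∈F)))

module _ {n} (G : Graph n) (F : List (Edge n)) {u v : Fin n} where

  deleteEdges-adj⁺ : adj G u v ≡ true → inEdges F u v ≡ false → adj (deleteEdges G F) u v ≡ true
  deleteEdges-adj⁺ uv uv∉F rewrite uv | uv∉F = refl

  deleteEdges-adj⁻ : adj (deleteEdges G F) u v ≡ true → adj G u v ≡ true × inEdges F u v ≡ false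
  deleteEdges-adj⁻ uv with adj G u v | inEdges F u v
  ... | true | false = refl , refl

reach-snoc : ∀ {n} {H : Graph n} {u a b} → Reach H u a → adj H a b ≡ true → Reach H u b
reach-snoc here       ab = step ab here
reach-snoc (step e p) ab = step e (reach-snoc p ab)

Closed : ∀ {n} → Graph n → Subset n → Set
Closed H S = ∀ {a b} → a ∈ₛ S → adj H a b ≡ true → b ∈ₛ S

∣S∣<∣S∪⁅b⁆∣ : ∀ {n} {S : Subset n} {b} → b ∉ₛ S → ∣ S ∣ < ∣ S ∪ ⁅ b ⁆ ∣
∣S∣<∣S∪⁅b⁆∣ {b = b} b∉S = p⊂q⇒∣p∣<∣q∣ (p⊆p∪q _ , b , x∈p∪q⁺ (inj₂ (x∈⁅x⁆ b)) , b∉S)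

reach-or-closed : ∀ {n} (H : Graph n) u v → Reach H u v ⊎ ∃ λ S → u ∈ₛ S × v ∉ₛ S × Closed H S
reach-or-closed {n} H u v = grow n ⁅ u ⁆ (x∈⁅x⁆ u) reach-⁅u⁆ (m≤m+n n _)
  where
  reach-⁅u⁆ : ∀ {w} → w ∈ₛ ⁅ u ⁆ → Reach H u w
  reach-⁅u⁆ w∈⁅u⁆ rewrite x∈⁅y⁆⇒x≡y u w∈⁅u⁆ = here
  leaving? : ∀ S → Dec (∃₂ λ a b → a ∈ₛ S × b ∉ₛ S × adj H a b ≡ true)
  leaving? S = any? λ a → any? λ b → (a ∈ₛ? S) ×-dec ¬? (b ∈ₛ? S) ×-dec (adj H a b Bool.≟ true)
  grow : ∀ fuel S → u ∈ₛ S → (∀ {w} → w ∈ₛ S → Reach H u w) → n ≤ fuel + ∣ S ∣ →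
         Reach H u v ⊎ ∃ λ S → u ∈ₛ S × v ∉ₛ S × Closed H S
  grow fuel S u∈S reachable bound with v ∈ₛ? S | leaving? S
  ... | yes v∈S | _ = inj₁ (reachable v∈S)
  ... | no v∉S  | no ¬leaving =
    inj₂ (S , u∈S , v∉S , λ {a} {b} a∈S ab → decidable-stable (b ∈ₛ? S) λ b∉S → ¬leaving (a , b , a∈S , b∉S , ab))
  grow zero S _ _ bound | no _ | yes (_ , b , _ , b∉S , _) =
    contradiction bound (<⇒≱ (<-≤-trans (∣S∣<∣S∪⁅b⁆∣ b∉S) (∣p∣≤n (S ∪ ⁅ b ⁆))))
  grow (suc fuel) S u∈S reachable bound | no _ | yes (a , b , a∈S , b∉S , ab) =
    grow fuel (S ∪ ⁅ b ⁆) (p⊆p∪q _ u∈S) reachable′ bound′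
    where
    reachable′ : ∀ {w} → w ∈ₛ S ∪ ⁅ b ⁆ → Reach H u w
    reachable′ w∈S′ with x∈p∪q⁻ S ⁅ b ⁆ w∈S′
    ... | inj₁ w∈S  = reachable w∈S
    ... | inj₂ w∈⁅b⁆ rewrite x∈⁅y⁆⇒x≡y b w∈⁅b⁆ = reach-snoc (reachable a∈S) ab
    bound′ : n ≤ fuel + ∣ S ∪ ⁅ b ⁆ ∣
    bound′ = begin
      n                      ≤⟨ bound ⟩
      suc (fuel + ∣ S ∣)      ≡⟨ +-suc fuel ∣ S ∣ ⟨
      fuel + suc ∣ S ∣        ≤⟨ +-monoʳ-≤ fuel (∣S∣<∣S∪⁅b⁆∣ b∉S) ⟩
      fuel + ∣ S ∪ ⁅ b ⁆ ∣    ∎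
      where open ≤-Reasoning

colorable-mono : ∀ {n} (H : Graph n) {j k} → j ≤ k → Colorable H j → Colorable H k
colorable-mono H j≤k (c , proper) =
  (λ w → inject≤ (c w) j≤k) , λ u v uv same → proper u v uv (inject≤-injective j≤k j≤k _ _ same)

colorable⇒¬¬χ≤ : ∀ {n} (H : Graph n) {k} → Colorable H k → ¬ ¬ (∃ λ j → ChromaticNumber H j × j ≤ k)
colorable⇒¬¬χ≤ H {zero}  colouring no-χ = no-χ (0 , (colouring , λ _ _ → z≤n) , z≤n)
colorable⇒¬¬χ≤ H {suc k} colouring no-χ = ¬¬-excluded-middle λ where
  (yes fewer) → colorable⇒¬¬χ≤ H fewer λ (j , χj , j≤k) → no-χ (j , χj , m≤n⇒m≤1+n j≤k)
  (no ¬fewer) → no-χ (suc k , (colouring , λ j cj → ≰⇒> λ j≤k → ¬fewer (colorable-mono H j≤k cj)) , ≤-refl)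

CoversMonochromatic : ∀ {n k} → Graph n → (Fin n → Fin k) → List (Edge n) → Set
CoversMonochromatic G c F = ∀ u v → adj G u v ≡ true → c u ≡ c v → inEdges F u v ≡ true

monochromaticCover-large : ∀ {n k r} {G : Graph n} {F : List (Edge n)} → KRGraph (suc k) r G →
  (c : Fin n → Fin k) → All (IsEdge G) F → CoversMonochromatic G c F → r < length F
monochromaticCover-large {G = G} {F} (_ , noCriticalSet) c F⊆E covers = ≰⇒> λ |F|≤r →
  colorable⇒¬¬χ≤ (deleteEdges G F) (c , c-proper) λ (j , χj , j≤k) → noCriticalSet F F⊆E |F|≤r (j , χj , s≤s j≤k)
  where
  c-proper : ∀ u v → adj (deleteEdges G F) u v ≡ true → c u ≢ c v
  c-proper u v uv same with deleteEdges-adj⁻ G F uv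
  ... | uv∈G , uv∉F with () ← trans (sym (covers u v uv∈G same)) uv∉F

record ProperOff {n k} (G : Graph n) (z : Fin n) (c : Fin n → Fin k) : Set where
  constructor properOff
  field
    proper : ∀ u v → u ≢ z → v ≢ z → adj G u v ≡ true → c u ≢ c v
open ProperOff

extendAt : ∀ {n k} → Fin (suc n) → (Fin n → Fin (suc k)) → Fin (suc n) → Fin (suc k)
extendAt z c w with z ≟ w
... | yes _   = zero
... | no z≢w  = c (punchOut z≢w)

extendAt-properOff : ∀ {n k} (G : Graph (suc n)) z (c : Fin n → Fin (suc k)) →
  (∀ a b → adj (deleteVertex G z) a b ≡ true → c a ≢ c b) → ProperOff G z (extendAt z c)
extendAt-properOff G z c proper-G∖z = properOff separates
  where
  separates : ∀ u v → u ≢ z → v ≢ z → adj G u v ≡ true → extendAt z c u ≢ extendAt z c v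
  separates u v u≢z v≢z uv with z ≟ u | z ≟ v
  ... | yes z≡u | _       = contradiction (sym z≡u) u≢z
  ... | no _    | yes z≡v = contradiction (sym z≡v) v≢z
  ... | no z≢u  | no z≢v  = proper-G∖z (punchOut z≢u) (punchOut z≢v) uv′
    where
    uv′ : adj G (punchIn z (punchOut z≢u)) (punchIn z (punchOut z≢v)) ≡ true
    uv′ rewrite punchIn-punchOut z≢u | punchIn-punchOut z≢v = uv

properOff-exists : ∀ {n k} (G : Graph n) → VertexCritical (suc (suc k)) G → (z : Fin n) →
  Σ (Fin n → Fin (suc k)) (ProperOff G z)
properOff-exists {suc n} G (_ , critical) z =
  let j , (colourable , _) , j<2+k = critical z
      c , proper-G∖z = colorable-mono (deleteVertex G z) (≤-pred j<2+k) colourable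
  in extendAt z c , extendAt-properOff G z c proper-G∖z

recolour : ∀ {n k} → Fin n → Fin k → (Fin n → Fin k) → Fin n → Fin k
recolour z a c w with z ≟ w
... | yes _ = a
... | no _  = c w

NeighbourColoured : ∀ {n k} → Graph n → (Fin n → Fin k) → Fin n → Fin k → Fin n → Set
NeighbourColoured G c z a w = adj G z w ≡ true × c w ≡ a

neighbourColoured? : ∀ {n k} (G : Graph n) (c : Fin n → Fin k) z a → Decidable (NeighbourColoured G c z a)
neighbourColoured? G c z a w = (adj G z w Bool.≟ true) ×-dec (c w ≟ a)

neighbourClass-large : ∀ {n k r} {G : Graph n} {z c} → KRGraph (suc k) r G → ProperOff G z c →
  ∀ a → r < count (neighbourColoured? G c z a)
neighbourClass-large {n} {r = r} {G} {z} {c} kr po a =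
  subst (r <_) |star|≡count (monochromaticCover-large kr (recolour z a c) star⊆E covers)
  where
  class : List (Fin n)
  class = filter (neighbourColoured? G c z a) (allFin n)
  star : List (Edge n)
  star = map (z ,_) class
  |star|≡count : length star ≡ count (neighbourColoured? G c z a)
  |star|≡count = trans (length-map _ class) (length-filter-allFin (neighbourColoured? G c z a))
  star⊆E : All (IsEdge G) star
  star⊆E = All.map⁺ (All.map proj₁ (all-filter _ (allFin n)))
  ∈star : ∀ {w} → NeighbourColoured G c z a w → (z , w) ∈ star
  ∈star {w} zw = ∈-map⁺ (z ,_) (∈-filter⁺ (neighbourColoured? G c z a) (∈-allFin w) zw)
  covers : CoversMonochromatic G (recolour z a c) star
  covers u v uv same with z ≟ u | z ≟ v
  ... | yes refl | yes refl = contradiction refl (adj⇒≢ G uv)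
  ... | yes refl | no _     = inEdges⁺ (inj₁ (∈star (uv , sym same)))
  ... | no _     | yes refl = inEdges⁺ (inj₂ (∈star (trans (Graph.sym G v u) uv , same)))
  ... | no z≢u   | no z≢v   = contradiction same (proper po u v (z≢u ∘ sym) (z≢v ∘ sym) uv)

degree-≥ : ∀ {n k r} {G : Graph n} → KRGraph (suc (suc k)) r G → ∀ v → suc k * suc r ≤ degree G v
degree-≥ {k = k} {r} {G} kr v with c , po ← properOff-exists G (proj₁ kr) v = begin
  suc k * suc r                                      ≡⟨ ∑-const (suc k) (suc r) ⟨
  ∑[ a < suc k ] suc r                               ≤⟨ ∑-mono-≤ (neighbourClass-large kr po) ⟩
  ∑[ a < suc k ] count (neighbourColoured? G c v a)  ≤⟨ ∑-count-classes≤count (λ w → adj G v w Bool.≟ true) c ⟩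
  count (λ w → adj G v w Bool.≟ true)                ≡⟨ degree≡count G v ⟨
  degree G v                                         ∎
  where open ≤-Reasoning

NonNeighbour : ∀ {n} → Graph n → Fin n → Fin n → Set
NonNeighbour G v w = w ≢ v × adj G v w ≡ false

nonNeighbour? : ∀ {n} (G : Graph n) v → Decidable (NonNeighbour G v)
nonNeighbour? G v w = ¬? (w ≟ v) ×-dec (adj G v w Bool.≟ false)

anotherVertex : ∀ {n k} {G : Graph n} → VertexCritical (suc (suc k)) G → (v : Fin n) → Σ (Fin n) (_≢ v)
anotherVertex {zero}  _ ()
anotherVertex {suc n} {G = G} ((_ , minimal) , _) v with any? (λ y → ¬? (y ≟ v))
... | yes found   = found
... | no only-v = contradiction (minimal 1 (const zero , edgeless)) λ { (s≤s ()) }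
  where
  ≡v : ∀ a → a ≡ v
  ≡v a = decidable-stable (a ≟ v) λ a≢v → only-v (a , a≢v)
  edgeless : ∀ a b → adj G a b ≡ true → const zero a ≢ const zero b
  edgeless a b ab _ = adj⇒≢ G ab (trans (≡v a) (sym (≡v b)))

-- This is where 1 ≤ r is needed: were v adjacent to all other vertices, the class of c(v) in N(y)
-- would be {v}.
nonNeighbour-exists : ∀ {n k r} {G : Graph n} → KRGraph (suc (suc k)) r G → 1 ≤ r → ∀ v → ∃ (NonNeighbour G v)
nonNeighbour-exists {G = G} kr 1≤r v with any? (nonNeighbour? G v)
... | yes found = found
... | no dominating
  with y , y≢v ← anotherVertex (proj₁ kr) v
  with c , po ← properOff-exists G (proj₁ kr) y =
  contradiction (≤-trans classIsV 1≤r) (<⇒≱ (neighbourClass-large kr po (c v)))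
  where
  ≡v : ∀ {w} → NeighbourColoured G c y (c v) w → w ≡ v
  ≡v {w} (yw , cw≡cv) = decidable-stable (w ≟ v) λ w≢v →
    proper po v w (y≢v ∘ sym) (adj⇒≢ G yw ∘ sym) (¬-not λ vw → dominating (w , w≢v , vw)) (sym cw≡cv)
  classIsV : count (neighbourColoured? G c y (c v)) ≤ 1
  classIsV = count≤1 (neighbourColoured? G c y (c v)) λ w∈K w′∈K → trans (≡v w∈K) (sym (≡v w′∈K))

module _ {n k} {G : Graph n} {x : Fin n} {c : Fin n → Fin k} (po : ProperOff G x c) where

  neighbourClass-independent : ∀ {a y w} → NeighbourColoured G c x a y → NeighbourColoured G c x a w → adj G y w ≢ true
  neighbourClass-independent (xy , cy≡a) (xw , cw≡a) yw =
    proper po _ _ (adj⇒≢ G xy ∘ sym) (adj⇒≢ G xw ∘ sym) yw (trans cy≡a (sym cw≡a))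

  neighbourClass⊆nonNeighbours : ∀ {v} → NonNeighbour G v x → NeighbourColoured G c x (c v) ⊆ NonNeighbour G v
  neighbourClass⊆nonNeighbours {v} (x≢v , vx) {w} (xw , cw≡cv) = w≢v , ¬-not vw≢true
    where
    w≢v : w ≢ v
    w≢v refl with () ← trans (sym xw) (trans (Graph.sym G x v) vx)
    vw≢true : adj G v w ≢ true
    vw≢true vw = proper po v w (x≢v ∘ sym) (adj⇒≢ G xw ∘ sym) vw (sym cw≡cv)

degree+nonNeighbours<n : ∀ {n} (G : Graph n) v → degree G v + count (nonNeighbour? G v) < n
degree+nonNeighbours<n {n} G v = begin-strict
  degree G v + count M?             ≡⟨ cong (_+ count M?) (degree≡count G v) ⟩
  count A? + count M?               <⟨ m<m+n _ (P⇒0<count E? refl) ⟩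
  count A? + count M? + count E?    ≡⟨ cong (_+ count E?) (count-∪ A? M? A∩M=∅) ⟨
  count (A? ∪? M?) + count E?       ≡⟨ count-∪ (A? ∪? M?) E? A∪M∩E=∅ ⟨
  count ((A? ∪? M?) ∪? E?)          ≤⟨ count≤n ((A? ∪? M?) ∪? E?) ⟩
  n                                 ∎
  where
  open ≤-Reasoning
  A? : Decidable (λ w → adj G v w ≡ true)
  A? w = adj G v w Bool.≟ true
  M? : Decidable (NonNeighbour G v)
  M? = nonNeighbour? G v
  E? : Decidable (_≡ v)
  E? w = w ≟ v
  A∩M=∅ : ∀ {w} → adj G v w ≡ true → NonNeighbour G v w → ⊥
  A∩M=∅ vw (_ , vw′) = contradiction (trans (sym vw) vw′) λ ()
  A∪M∩E=∅ : ∀ {w} → adj G v w ≡ true ⊎ NonNeighbour G v w → w ≡ v → ⊥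
  A∪M∩E=∅ (inj₁ vw)        w≡v = adj⇒≢ G vw (sym w≡v)
  A∪M∩E=∅ (inj₂ (w≢v , _)) w≡v = w≢v w≡v

degree+2r+3≤n : ∀ {n k r} {G : Graph n} → KRGraph (suc (suc k)) r G → 1 ≤ r → ∀ v → degree G v + (2 * r + 3) ≤ n
degree+2r+3≤n {n} {r = r} {G = G} kr 1≤r v
  with x , x∉N[v] ← nonNeighbour-exists kr 1≤r v
  with cₓ , poₓ ← properOff-exists G (proj₁ kr) x
  with y , y∈Kₓ ← 0<count⇒∃ (neighbourColoured? G cₓ x (cₓ v))
                             (≤-trans (s≤s z≤n) (neighbourClass-large kr poₓ (cₓ v)))
  with c_y , po_y ← properOff-exists G (proj₁ kr) y = begin
  degree G v + (2 * r + 3)                         ≡⟨ rearrange (degree G v) r ⟩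
  suc (degree G v + (suc r + suc r))               ≤⟨ s≤s (+-monoʳ-≤ (degree G v) (+-mono-≤ Kₓ-large K_y-large)) ⟩
  suc (degree G v + (count Kₓ? + count K_y?))      ≤⟨ s≤s (+-monoʳ-≤ (degree G v) classes≤nonNeighbours) ⟩
  suc (degree G v + count (nonNeighbour? G v))     ≤⟨ degree+nonNeighbours<n G v ⟩
  n                                                ∎
  where
  open ≤-Reasoning
  rearrange : ∀ d r → d + (2 * r + 3) ≡ suc (d + (suc r + suc r))
  rearrange = solve-∀
  Kₓ? : Decidable (NeighbourColoured G cₓ x (cₓ v))
  Kₓ? = neighbourColoured? G cₓ x (cₓ v)
  K_y? : Decidable (NeighbourColoured G c_y y (c_y v))
  K_y? = neighbourColoured? G c_y y (c_y v)
  Kₓ-large : r < count Kₓ?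
  Kₓ-large = neighbourClass-large kr poₓ (cₓ v)
  K_y-large : r < count K_y?
  K_y-large = neighbourClass-large kr po_y (c_y v)
  Kₓ∩K_y=∅ : ∀ {w} → NeighbourColoured G cₓ x (cₓ v) w → NeighbourColoured G c_y y (c_y v) w → ⊥
  Kₓ∩K_y=∅ w∈Kₓ (yw , _) = neighbourClass-independent poₓ y∈Kₓ w∈Kₓ yw
  y∉N[v] : NonNeighbour G v y
  y∉N[v] = neighbourClass⊆nonNeighbours poₓ x∉N[v] y∈Kₓ
  classes≤nonNeighbours : count Kₓ? + count K_y? ≤ count (nonNeighbour? G v)
  classes≤nonNeighbours = begin
    count Kₓ? + count K_y?      ≡⟨ count-∪ Kₓ? K_y? Kₓ∩K_y=∅ ⟨
    count (Kₓ? ∪? K_y?)         ≤⟨ count-mono (Kₓ? ∪? K_y?) (nonNeighbour? G v)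
                                     Sum.[ neighbourClass⊆nonNeighbours poₓ x∉N[v]
                                         , neighbourClass⊆nonNeighbours po_y y∉N[v] ] ⟩
    count (nonNeighbour? G v)   ∎

_⊕_ : Fin 3 → Fin 3 → Fin 3
s ⊕ x = (toℕ s + toℕ x) mod 3

⊕-cancelˡ : ∀ s x y → s ⊕ x ≡ s ⊕ y → x ≡ y
⊕-cancelˡ = from-yes (all? λ s → all? λ x → all? λ y → (s ⊕ x ≟ s ⊕ y) →-dec (x ≟ y))

⊕-cancelʳ : ∀ s t x → s ⊕ x ≡ t ⊕ x → s ≡ t
⊕-cancelʳ = from-yes (all? λ s → all? λ t → all? λ x → (s ⊕ x ≟ t ⊕ x) →-dec (s ≟ t))

edgeCut-large : ∀ {n r} {G : Graph n} {F : List (Edge n)} → KRGraph 4 r G → All (IsEdge G) F →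
  ∀ (S : Subset n) {u w} → u ∈ₛ S → w ∉ₛ S →
  (∀ {a b} → a ∈ₛ S → b ∉ₛ S → adj G a b ≡ true → inEdges F a b ≡ true) → 3 * suc r ≤ length F
edgeCut-large {n} {r} {G} {F} kr F⊆E S {u} {w} u∈S w∉S crossing⊆F
  with d₁ , po₁ ← properOff-exists G (proj₁ kr) w
  with d₂ , po₂ ← properOff-exists G (proj₁ kr) u = begin
  3 * suc r                                 ≡⟨ ∑-const 3 (suc r) ⟨
  ∑[ s < 3 ] suc r                          ≤⟨ ∑-mono-≤ manyMonochromatic ⟩
  ∑[ s < 3 ] length (filter (mono? s) F)    ≤⟨ ∑-length-filter≤length mono? (All.map (λ {e} → atMostOneShift e) F⊆E) ⟩
  length F                                  ∎
  where
  open ≤-Reasoning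
  colour : Fin 3 → Fin n → Fin 3
  colour s v with v ∈ₛ? S
  ... | yes _ = d₁ v
  ... | no _  = s ⊕ d₂ v
  mono? : ∀ s → Decidable (λ (e : Edge n) → colour s (proj₁ e) ≡ colour s (proj₂ e))
  mono? s (a , b) = colour s a ≟ colour s b
  inside≢w : ∀ {a} → a ∈ₛ S → a ≢ w
  inside≢w a∈S refl = w∉S a∈S
  outside≢u : ∀ {a} → a ∉ₛ S → a ≢ u
  outside≢u a∉S refl = a∉S u∈S
  crossing : ∀ s a b → adj G a b ≡ true → colour s a ≡ colour s b → inEdges F a b ≡ true
  crossing s a b ab same with a ∈ₛ? S | b ∈ₛ? S
  ... | yes a∈S | yes b∈S = contradiction same (proper po₁ a b (inside≢w a∈S) (inside≢w b∈S) ab)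
  ... | no a∉S  | no b∉S  = contradiction (⊕-cancelˡ s _ _ same) (proper po₂ a b (outside≢u a∉S) (outside≢u b∉S) ab)
  ... | yes a∈S | no b∉S  = crossing⊆F a∈S b∉S ab
  ... | no a∉S  | yes b∈S = inEdges⁺ (Sum.swap (inEdges⁻ F b a (crossing⊆F b∈S a∉S (trans (Graph.sym G b a) ab))))
  covers : ∀ s → CoversMonochromatic G (colour s) (filter (mono? s) F)
  covers s a b ab same = inEdges⁺ (Sum.map (λ ab∈F → ∈-filter⁺ (mono? s) ab∈F same)
                                           (λ ba∈F → ∈-filter⁺ (mono? s) ba∈F (sym same))
                                           (inEdges⁻ F a b (crossing s a b ab same)))
  manyMonochromatic : ∀ s → r < length (filter (mono? s) F)
  manyMonochromatic s = monochromaticCover-large kr (colour s) (All.filter⁺ (mono? s) F⊆E) (covers s)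
  uniqueShift : ∀ a b → adj G a b ≡ true → ∀ {s t} → colour s a ≡ colour s b → colour t a ≡ colour t b → s ≡ t
  uniqueShift a b ab {s} {t} same-s same-t with a ∈ₛ? S | b ∈ₛ? S
  ... | yes a∈S | yes b∈S = contradiction same-s (proper po₁ a b (inside≢w a∈S) (inside≢w b∈S) ab)
  ... | no a∉S  | no b∉S  = contradiction (⊕-cancelˡ s _ _ same-s) (proper po₂ a b (outside≢u a∉S) (outside≢u b∉S) ab)
  ... | yes _   | no _    = ⊕-cancelʳ s t _ (trans (sym same-s) same-t)
  ... | no _    | yes _   = ⊕-cancelʳ s t _ (trans same-s (sym same-t))
  atMostOneShift : ∀ e → IsEdge G e → count (λ s → mono? s e) ≤ 1
  atMostOneShift (a , b) ab = count≤1 (λ s → mono? s (a , b)) (uniqueShift a b ab)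

edgeConnectivity-≥ : ∀ {n r} {G : Graph n} → KRGraph 4 r G → EdgeConnectivityAtLeast G (3 * suc r)
edgeConnectivity-≥ {G = G} kr F F⊆E |F|<3[1+r] u v with reach-or-closed (deleteEdges G F) u v
... | inj₁ path = path
... | inj₂ (S , u∈S , v∉S , closed) = contradiction (edgeCut-large kr F⊆E S u∈S v∉S crossing⊆F) (<⇒≱ |F|<3[1+r])
  where
  crossing⊆F : ∀ {a b} → a ∈ₛ S → b ∉ₛ S → adj G a b ≡ true → inEdges F a b ≡ true
  crossing⊆F a∈S b∉S ab = ¬-not λ ab∉F → b∉S (closed a∈S (deleteEdges-adj⁺ G F ab ab∉F))

krGraph-vertex : ∀ {n k r} {G : Graph n} → KRGraph (suc k) r G → Fin n
krGraph-vertex {zero}  ((_ , minimal) , _) with () ← minimal 0 ((λ ()) , λ ())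
krGraph-vertex {suc n} _ = zero

proposition5p1 : (r : ℕ) → 1 ≤ r → (n : ℕ) → (G : Graph n) → KRGraph 4 r G →
    EdgeConnectivityAtLeast G (3 * r + 3)
    × (∀ (v : Fin n) → 3 * r + 3 ≤ degree G v)
    × (∀ (v : Fin n) → degree G v + (2 * r + 3) ≤ n)
    × (5 * r + 6 ≤ n)
proposition5p1 r 1≤r n G kr =
  subst (EdgeConnectivityAtLeast G) (3[1+r]≡3r+3 r) (edgeConnectivity-≥ kr) , minDegree , maxDegree , order
  where
  3[1+r]≡3r+3 : ∀ r → 3 * suc r ≡ 3 * r + 3
  3[1+r]≡3r+3 = solve-∀
  5r+6≡3r+3+2r+3 : ∀ r → 5 * r + 6 ≡ (3 * r + 3) + (2 * r + 3)
  5r+6≡3r+3+2r+3 = solve-∀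
  minDegree : ∀ v → 3 * r + 3 ≤ degree G v
  minDegree v = subst (_≤ degree G v) (3[1+r]≡3r+3 r) (degree-≥ kr v)
  maxDegree : ∀ v → degree G v + (2 * r + 3) ≤ n
  maxDegree = degree+2r+3≤n kr 1≤r
  order : 5 * r + 6 ≤ n
  order = let v = krGraph-vertex kr in begin
    5 * r + 6                    ≡⟨ 5r+6≡3r+3+2r+3 r ⟩
    (3 * r + 3) + (2 * r + 3)    ≤⟨ +-monoˡ-≤ (2 * r + 3) (minDegree v) ⟩
    degree G v + (2 * r + 3)     ≤⟨ maxDegree v ⟩
    n                            ∎
    where open ≤-Reasoning
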